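{- (2-cut with residual) Let $R_1,R_2\subseteq\Omega$ be such that $\overline{R_1}$ and $\overline{R_2}$ are disjoint. For all sequents $\Gamma_1,\Gamma_2$ and every formula $A$ of MRL, if $\vdash\Gamma_1,R_1\{A\}$ and $\vdash\Gamma_2,R_2\{A\}$ are derivable in MRL, then $\vdash\Gamma_1,\Gamma_2,(R_1\cap R_2)\{A\}$ is derivable in MRL.
   Context: Fix a set $\Omega$ of roles (possibly infinite). A role set is a subset $R\subseteq\Omega$; $\overline{R}=\Omega\setminus R$; $R_1\uplus\cdots\uplus R_n=\Omega$ means the $R_i$ are pairwise disjoint with union $\Omega$. An ultrafilter on $\Omega$ is a family $\mathcal U$ of subsets of $\Omega$ with $\Omega\in\mathcal U$, closed upward and under binary intersection, and containing $R$ or $\overline R$ for every $R$. For an endomorphism $f:\Omega\to\Omega$, $f^{ -1}(R)=\{r\mid f(r)\in R\}$. Formulas of MRL, over first-order terms $t$ and variables $x$: $A,B::=a\mid\neg_f(A)\mid A\wedge_{\mathcal U}B\mid\forall_{\mathcal U}(\lambda x.A)$ ($a$ primitive formulas, $f$ endomorphisms of $\Omega$, $\mathcal U$ ultrafilters); $A[x:=t]$ is substitution. An i-formula is $R\{A\}$ with $R\subseteq\Omega$; a sequent $\Gamma$ is a finite multiset of i-formulas. Derivable sequents $\vdash\Gamma$ are generated by: (Id) $\vdash R_1\{a\},\ldots,R_n\{a\}$ whenever $R_1\uplus\cdots\uplus R_n=\Omega$; (Weaken) from $\Gamma$ infer $\Gamma,R\{A\}$; (Contract) from $\Gamma,R\{A\},R\{A\}$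 infer $\Gamma,R\{A\}$; ($\neg$) from $\Gamma,f^{ -1}(R)\{A\}$ infer $\Gamma,R\{\neg_f(A)\}$; ($\wedge$-neg-l/r) if $R\notin\mathcal U$, from $\Gamma,R\{A\}$ (resp. $\Gamma,R\{B\}$) infer $\Gamma,R\{A\wedge_{\mathcal U}B\}$; ($\wedge$-pos) if $R\in\mathcal U$, from $\Gamma,R\{A\}$ and $\Gamma,R\{B\}$ infer $\Gamma,R\{A\wedge_{\mathcal U}B\}$; ($\forall$-neg) if $R\notin\mathcal U$, from $\Gamma,R\{A[x:=t]\}$ infer $\Gamma,R\{\forall_{\mathcal U}(\lambda x.A)\}$; ($\forall$-pos) if $R\in\mathcal U$ and $x$ not free in $\Gamma$, from $\Gamma,R\{A\}$ infer $\Gamma,R\{\forall_{\mathcal U}(\lambda x.A)\}$. -}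

module Defs where

open import Data.Bool using (Bool; true; false; _∧_; not)
open import Data.Nat using (ℕ; zero; suc; _<ᵇ_; _≡ᵇ_; pred)
open import Data.List using (List; []; _∷_; map; length; lookup)
open import Data.Fin using (Fin)
open import Data.Product using (Σ; _×_)
open import Data.Empty using (⊥)
open import Relation.Nullary using (¬_)
open import Relation.Binary.PropositionalEquality using (_≡_)
open import Data.List.Relation.Binary.Permutation.Propositional using (_↭_)
open import Data.Sum using (_⊎_)

-- Role sets: subsets of Ω, represented (classically) as Ω → Bool.

RoleSet : Set → Set
RoleSet Ω = Ω → Bool

∁ : {Ω : Set} → RoleSet Ω → RoleSet Ω
∁ R r = not (R r)

_∩_ : {Ω : Set} → RoleSet Ω → RoleSet Ω → RoleSet Ω
(R ∩ S) r = R r ∧ S r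

Full : {Ω : Set} → RoleSet Ω
Full r = true

_⊆_ : {Ω : Set} → RoleSet Ω → RoleSet Ω → Set
R ⊆ S = ∀ r → R r ≡ true → S r ≡ true

preimage : {Ω : Set} → (Ω → Ω) → RoleSet Ω → RoleSet Ω
preimage f R r = R (f r)

-- R₁ ⊎ ⋯ ⊎ Rₙ = Ω : pairwise disjoint (distinct positions) with union Ω
IsPartition : {Ω : Set} → List (RoleSet Ω) → Set
IsPartition {Ω} Rs =
  (∀ (r : Ω) → Σ (Fin (length Rs)) (λ i → lookup Rs i r ≡ true)) ×
  (∀ (r : Ω) (i j : Fin (length Rs)) →
     lookup Rs i r ≡ true → lookup Rs j r ≡ true → i ≡ j)

record Ultrafilter (Ω : Set) : Set₁ where
  field
    _∈U    : RoleSet Ω → Set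
    full   : Full ∈U
    upward : ∀ {R S} → R ⊆ S → R ∈U → S ∈U
    inter  : ∀ {R S} → R ∈U → S ∈U → (R ∩ S) ∈U
    ultra  : ∀ R → R ∈U ⊎ (∁ R) ∈U

open Ultrafilter public

-- First-order terms (de Bruijn indices for variables; function and
-- predicate symbols named by natural numbers).

data Term : Set where
  var : ℕ → Term
  app : ℕ → List Term → Term

mutual
  shiftT : ℕ → Term → Term
  shiftT c (var n) with n <ᵇ c
  ... | true  = var n
  ... | false = var (suc n)
  shiftT c (app f ts) = app f (shiftTs c ts)

  shiftTs : ℕ → List Term → List Term
  shiftTs c []       = []
  shiftTs c (t ∷ ts) = shiftT c t ∷ shiftTs c ts

mutual
  substT : ℕ → Term → Term → Term
  substT k t (var n) with n <ᵇ k | n ≡ᵇ k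
  ... | true  | _     = var n
  ... | false | true  = t
  ... | false | false = var (pred n)
  substT k t (app f ts) = app f (substTs k t ts)

  substTs : ℕ → Term → List Term → List Term
  substTs k t []       = []
  substTs k t (u ∷ us) = substT k t u ∷ substTs k t us

data Formula (Ω : Set) : Set₁ where
  atom : ℕ → List Term → Formula Ω
  neg  : (Ω → Ω) → Formula Ω → Formula Ω
  conj : Ultrafilter Ω → Formula Ω → Formula Ω → Formula Ω
  all  : Ultrafilter Ω → Formula Ω → Formula Ω              -- ∀_U(λx.A), x = index 0

shiftF : {Ω : Set} → ℕ → Formula Ω → Formula Ω
shiftF c (atom p ts)  = atom p (shiftTs c ts)
shiftF c (neg f A)    = neg f (shiftF c A)
shiftF c (conj U A B) = conj U (shiftF c A) (shiftF c B)
shiftF c (all U A)    = all U (shiftF (suc c) A)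

substF : {Ω : Set} → ℕ → Term → Formula Ω → Formula Ω
substF k t (atom p ts)  = atom p (substTs k t ts)
substF k t (neg f A)    = neg f (substF k t A)
substF k t (conj U A B) = conj U (substF k t A) (substF k t B)
substF k t (all U A)    = all U (substF (suc k) (shiftT 0 t) A)

_[0:=_] : {Ω : Set} → Formula Ω → Term → Formula Ω
A [0:= t ] = substF 0 t A

-- i-formulas and sequents (multisets = lists up to permutation, see Exch)

record IFormula (Ω : Set) : Set₁ where
  constructor _⟨_⟩
  field
    roles   : RoleSet Ω
    formula : Formula Ω

Sequent : Set → Set₁
Sequent Ω = List (IFormula Ω)

shiftSeq : {Ω : Set} → Sequent Ω → Sequent Ω
shiftSeq = map (λ { (R ⟨ A ⟩) → R ⟨ shiftF 0 A ⟩ })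

data ⊢_ {Ω : Set} : Sequent Ω → Set₁ where
  Id       : ∀ (Rs : List (RoleSet Ω)) p ts → IsPartition Rs →
             ⊢ map (λ R → R ⟨ atom p ts ⟩) Rs
  Exch     : ∀ {Γ Δ} → Γ ↭ Δ → ⊢ Γ → ⊢ Δ
  Weaken   : ∀ {Γ} R A → ⊢ Γ → ⊢ (R ⟨ A ⟩ ∷ Γ)
  Contract : ∀ {Γ R A} → ⊢ (R ⟨ A ⟩ ∷ R ⟨ A ⟩ ∷ Γ) → ⊢ (R ⟨ A ⟩ ∷ Γ)
  Neg      : ∀ {Γ R f A} → ⊢ (preimage f R ⟨ A ⟩ ∷ Γ) → ⊢ (R ⟨ neg f A ⟩ ∷ Γ)
  AndNegL  : ∀ {Γ R U A B} → ¬ ((U ∈U) R) →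
             ⊢ (R ⟨ A ⟩ ∷ Γ) → ⊢ (R ⟨ conj U A B ⟩ ∷ Γ)
  AndNegR  : ∀ {Γ R U A B} → ¬ ((U ∈U) R) →
             ⊢ (R ⟨ B ⟩ ∷ Γ) → ⊢ (R ⟨ conj U A B ⟩ ∷ Γ)
  AndPos   : ∀ {Γ R U A B} → (U ∈U) R →
             ⊢ (R ⟨ A ⟩ ∷ Γ) → ⊢ (R ⟨ B ⟩ ∷ Γ) → ⊢ (R ⟨ conj U A B ⟩ ∷ Γ)
  AllNeg   : ∀ {Γ R U A} (t : Term) → ¬ ((U ∈U) R) →
             ⊢ (R ⟨ A [0:= t ] ⟩ ∷ Γ) → ⊢ (R ⟨ all U A ⟩ ∷ Γ)
  -- eigenvariable condition: the fresh variable (index 0) does not occur in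
  -- the shifted context
  AllPos   : ∀ {Γ R U A} → (U ∈U) R →
             ⊢ (R ⟨ A ⟩ ∷ shiftSeq Γ) → ⊢ (R ⟨ all U A ⟩ ∷ Γ)

{-# OPTIONS --safe #-}
-- Cut elimination by induction on the depth of the cut formula A.
--
-- Atomic A: the axioms above the two premises partition Ω.  Restricting the
-- axioms of the first premise to R₁ ∩ R₂ leaves, together with their other
-- members, a partition of R₂; splitting the R₂-atom of the second premise
-- along it yields the conclusion.  This needs R₁ ∪ R₂ = Ω.
--
-- Compound A: since R₁ ∪ R₂ = Ω, every ultrafilter U contains R₁ or R₂
-- (if not R₁, then its complement, which lies inside R₂).  So on one side
-- the rule introducing A is the invertible one (the U-positive rule, or the
-- rule for ¬_f).  Invert that side, and push the cut up through the other
-- derivation to every rule introducing A; there the cut reduces to cuts on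
-- immediate subformulas or instances.  Contraction is handled by tracking all
-- copies of the cut formula at once.
module Submission where

open import Defs
open import Level using (Level)
open import Data.Bool using (Bool; true; false; _∧_)
open import Data.Bool.Properties using (∧-comm; ∧-conicalʳ)
open import Data.Empty using (⊥; ⊥-elim)
open import Data.Fin using (Fin) renaming (zero to fzero; suc to fsuc)
import Data.Fin.Properties as Fin
open import Data.List using (List; []; _∷_; _++_; map; replicate; lookup; length)
open import Data.List.Properties using (map-++; map-∘; map-id; map-replicate)
open import Data.List.Membership.Propositional.Properties using (∈-++⁻; ∈-∃++; ∈-map⁻)
open import Data.List.Relation.Unary.All as All using (All; []; _∷_)
open import Data.List.Relation.Unary.All.Properties using (++⁻ʳ; replicate⁺)
open import Data.List.Relation.Unary.Any using (here)
open import Data.List.Relation.Binary.Permutation.Propositional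
  using (_↭_; prep; ↭-refl; ↭-trans; ↭-sym; ↭-reflexive)
open import Data.List.Relation.Binary.Permutation.Propositional.Properties
  using (shift; ++⁺ˡ; ++-comm; map⁺; drop-∷; ∈-resp-↭)
open import Data.Nat using (ℕ; zero; suc; _+_; _*_; _<_; _⊔_; s≤s; _<ᵇ_; _≡ᵇ_)
open import Data.Nat.Induction using (<-wellFounded)
open import Data.Nat.ListAction using (sum)
open import Data.Nat.ListAction.Properties using (sum-++; sum-↭)
open import Data.Nat.Properties
  using (≤-refl; ≤-reflexive; m≤m⊔n; m≤n⊔m; *-zeroʳ; +-assoc; suc-injective)
open import Data.Product using (Σ; _,_; proj₂)
open import Data.Sum using (_⊎_; inj₁; inj₂)
open import Data.Unit using (⊤; tt)
open import Function using (id; _∘_)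
open import Induction.WellFounded using (Acc; acc)
open import Relation.Nullary using (¬_)
open import Relation.Binary.PropositionalEquality
  using (_≡_; _≢_; refl; sym; trans; cong; cong₂; subst; subst₂; _≗_; module ≡-Reasoning)

private variable
  a b : Level
  Ω : Set
  k n p : ℕ
  ts : List Term
  A B : Formula Ω
  R S T R₁ R₂ : RoleSet Ω
  Rs Qs Ps M : List (RoleSet Ω)
  Γ Γ₁ Γ₂ : Sequent Ω

Subst : Set
Subst = ℕ → Term

mutual
  subT : Subst → Term → Term
  subT σ (var n)    = σ n
  subT σ (app f ts) = app f (subTs σ ts)

  subTs : Subst → List Term → List Term
  subTs σ []       = []
  subTs σ (t ∷ ts) = subT σ t ∷ subTs σ ts

lift : Subst → Subst
lift σ zero    = var zero
lift σ (suc n) = shiftT 0 (σ n)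

subF : Subst → Formula Ω → Formula Ω
subF σ (atom p ts)  = atom p (subTs σ ts)
subF σ (neg f A)    = neg f (subF σ A)
subF σ (conj U A B) = conj U (subF σ A) (subF σ B)
subF σ (all U A)    = all U (subF (lift σ) A)

shiftσ : ℕ → Subst
shiftσ c n = shiftT c (var n)

substσ : ℕ → Term → Subst
substσ k t n = substT k t (var n)

infixr 9 _⊙_
_⊙_ : Subst → Subst → Subst
(σ ⊙ τ) n = subT σ (τ n)

mutual
  subT-cong : ∀ {σ τ} → σ ≗ τ → subT σ ≗ subT τ
  subT-cong eq (var n)    = eq n
  subT-cong eq (app f ts) = cong (app f) (subTs-cong eq ts)

  subTs-cong : ∀ {σ τ} → σ ≗ τ → subTs σ ≗ subTs τ
  subTs-cong eq []       = refl
  subTs-cong eq (t ∷ ts) = cong₂ _∷_ (subT-cong eq t) (subTs-cong eq ts)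

lift-cong : ∀ {σ τ} → σ ≗ τ → lift σ ≗ lift τ
lift-cong eq zero    = refl
lift-cong eq (suc n) = cong (shiftT 0) (eq n)

subF-cong : ∀ {σ τ} → σ ≗ τ → (A : Formula Ω) → subF σ A ≡ subF τ A
subF-cong eq (atom p ts)  = cong (atom p) (subTs-cong eq ts)
subF-cong eq (neg f A)    = cong (neg f) (subF-cong eq A)
subF-cong eq (conj U A B) = cong₂ (conj U) (subF-cong eq A) (subF-cong eq B)
subF-cong eq (all U A)    = cong (all U) (subF-cong (lift-cong eq) A)

mutual
  subT-⊙ : ∀ σ τ t → subT σ (subT τ t) ≡ subT (σ ⊙ τ) t
  subT-⊙ σ τ (var n)    = refl
  subT-⊙ σ τ (app f ts) = cong (app f) (subTs-⊙ σ τ ts)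

  subTs-⊙ : ∀ σ τ ts → subTs σ (subTs τ ts) ≡ subTs (σ ⊙ τ) ts
  subTs-⊙ σ τ []       = refl
  subTs-⊙ σ τ (t ∷ ts) = cong₂ _∷_ (subT-⊙ σ τ t) (subTs-⊙ σ τ ts)

mutual
  subT-var : subT var ≗ id
  subT-var (var n)    = refl
  subT-var (app f ts) = cong (app f) (subTs-var ts)

  subTs-var : subTs var ≗ id
  subTs-var []       = refl
  subTs-var (t ∷ ts) = cong₂ _∷_ (subT-var t) (subTs-var ts)

mutual
  shiftT-sub : ∀ c → shiftT c ≗ subT (shiftσ c)
  shiftT-sub c (var n)    = refl
  shiftT-sub c (app f ts) = cong (app f) (shiftTs-sub c ts)

  shiftTs-sub : ∀ c → shiftTs c ≗ subTs (shiftσ c)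
  shiftTs-sub c []       = refl
  shiftTs-sub c (t ∷ ts) = cong₂ _∷_ (shiftT-sub c t) (shiftTs-sub c ts)

mutual
  substT-sub : ∀ k t → substT k t ≗ subT (substσ k t)
  substT-sub k t (var n)    = refl
  substT-sub k t (app f ts) = cong (app f) (substTs-sub k t ts)

  substTs-sub : ∀ k t → substTs k t ≗ subTs (substσ k t)
  substTs-sub k t []       = refl
  substTs-sub k t (u ∷ us) = cong₂ _∷_ (substT-sub k t u) (substTs-sub k t us)

lift-⊙ : ∀ σ τ → lift σ ⊙ lift τ ≗ lift (σ ⊙ τ)
lift-⊙ σ τ zero    = refl
lift-⊙ σ τ (suc n) = begin
  subT (lift σ) (shiftT 0 (τ n))          ≡⟨ cong (subT (lift σ)) (shiftT-sub 0 (τ n)) ⟩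
  subT (lift σ) (subT (shiftσ 0) (τ n))   ≡⟨ subT-⊙ (lift σ) (shiftσ 0) (τ n) ⟩
  subT (lift σ ⊙ shiftσ 0) (τ n)          ≡⟨ subT-cong (shiftT-sub 0 ∘ σ) (τ n) ⟩
  subT (shiftσ 0 ⊙ σ) (τ n)               ≡⟨ sym (subT-⊙ (shiftσ 0) σ (τ n)) ⟩
  subT (shiftσ 0) (subT σ (τ n))          ≡⟨ sym (shiftT-sub 0 (subT σ (τ n))) ⟩
  shiftT 0 (subT σ (τ n))                 ∎
  where open ≡-Reasoning

lift-shiftσ : ∀ c → lift (shiftσ c) ≗ shiftσ (suc c)
lift-shiftσ c zero = refl
lift-shiftσ c (suc n) with n <ᵇ c
... | true  = refl
... | false = refl

lift-substσ : ∀ k t → lift (substσ k t) ≗ substσ (suc k) (shiftT 0 t)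
lift-substσ k       t zero          = refl
lift-substσ zero    t (suc zero)    = refl
lift-substσ zero    t (suc (suc n)) = refl
lift-substσ (suc k) t (suc zero)    = refl
lift-substσ (suc k) t (suc (suc n)) with n <ᵇ k | n ≡ᵇ k
... | true  | _     = refl
... | false | true  = refl
... | false | false = refl

lift-var : lift var ≗ var
lift-var zero    = refl
lift-var (suc n) = refl

subF-⊙ : ∀ σ τ (A : Formula Ω) → subF σ (subF τ A) ≡ subF (σ ⊙ τ) A
subF-⊙ σ τ (atom p ts)  = cong (atom p) (subTs-⊙ σ τ ts)
subF-⊙ σ τ (neg f A)    = cong (neg f) (subF-⊙ σ τ A)
subF-⊙ σ τ (conj U A B) = cong₂ (conj U) (subF-⊙ σ τ A) (subF-⊙ σ τ B)
subF-⊙ σ τ (all U A)    =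
  cong (all U) (trans (subF-⊙ (lift σ) (lift τ) A) (subF-cong (lift-⊙ σ τ) A))

subF-id : ∀ {σ} → σ ≗ var → (A : Formula Ω) → subF σ A ≡ A
subF-id eq (atom p ts)  = cong (atom p) (trans (subTs-cong eq ts) (subTs-var ts))
subF-id eq (neg f A)    = cong (neg f) (subF-id eq A)
subF-id eq (conj U A B) = cong₂ (conj U) (subF-id eq A) (subF-id eq B)
subF-id eq (all U A)    = cong (all U) (subF-id (λ n → trans (lift-cong eq n) (lift-var n)) A)

shiftF-sub : ∀ c (A : Formula Ω) → shiftF c A ≡ subF (shiftσ c) A
shiftF-sub c (atom p ts)  = cong (atom p) (shiftTs-sub c ts)
shiftF-sub c (neg f A)    = cong (neg f) (shiftF-sub c A)
shiftF-sub c (conj U A B) = cong₂ (conj U) (shiftF-sub c A) (shiftF-sub c B)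
shiftF-sub c (all U A)    =
  cong (all U) (trans (shiftF-sub (suc c) A) (sym (subF-cong (lift-shiftσ c) A)))

substF-sub : ∀ k t (A : Formula Ω) → substF k t A ≡ subF (substσ k t) A
substF-sub k t (atom p ts)  = cong (atom p) (substTs-sub k t ts)
substF-sub k t (neg f A)    = cong (neg f) (substF-sub k t A)
substF-sub k t (conj U A B) = cong₂ (conj U) (substF-sub k t A) (substF-sub k t B)
substF-sub k t (all U A)    =
  cong (all U) (trans (substF-sub (suc k) (shiftT 0 t) A) (sym (subF-cong (lift-substσ k t) A)))

-- shiftF and substF act as substitutions, so each law relating them below
-- reduces to an identity between two composite substitutions on variables.
Realizes : Subst → (Formula Ω → Formula Ω) → Set₁
Realizes σ F = ∀ A → F A ≡ subF σ A

composites-agree : ∀ {σ₁ τ₁ σ₂ τ₂} {F₁ G₁ F₂ G₂ : Formula Ω → Formula Ω} →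
  Realizes σ₁ F₁ → Realizes τ₁ G₁ → Realizes σ₂ F₂ → Realizes τ₂ G₂ →
  σ₁ ⊙ τ₁ ≗ σ₂ ⊙ τ₂ → ∀ A → F₁ (G₁ A) ≡ F₂ (G₂ A)
composites-agree {σ₁ = σ₁} {τ₁} {σ₂} {τ₂} {F₁} {G₁} {F₂} {G₂} rF₁ rG₁ rF₂ rG₂ eq A =
  begin
  F₁ (G₁ A)                ≡⟨ trans (rF₁ (G₁ A)) (cong (subF σ₁) (rG₁ A)) ⟩
  subF σ₁ (subF τ₁ A)      ≡⟨ subF-⊙ σ₁ τ₁ A ⟩
  subF (σ₁ ⊙ τ₁) A         ≡⟨ subF-cong eq A ⟩
  subF (σ₂ ⊙ τ₂) A         ≡⟨ sym (subF-⊙ σ₂ τ₂ A) ⟩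
  subF σ₂ (subF τ₂ A)      ≡⟨ sym (trans (rF₂ (G₂ A)) (cong (subF σ₂) (rG₂ A))) ⟩
  F₂ (G₂ A)                ∎
  where open ≡-Reasoning

composite-id : ∀ {σ τ} {F G : Formula Ω → Formula Ω} →
  Realizes σ F → Realizes τ G → σ ⊙ τ ≗ var → ∀ A → F (G A) ≡ A
composite-id {σ = σ} {τ} rF rG eq A =
  trans (trans (rF _) (cong (subF σ) (rG A))) (trans (subF-⊙ σ τ A) (subF-id eq A))

shiftF-shiftF : ∀ c (A : Formula Ω) → shiftF (suc c) (shiftF 0 A) ≡ shiftF 0 (shiftF c A)
shiftF-shiftF c =
  composites-agree (shiftF-sub (suc c)) (shiftF-sub 0) (shiftF-sub 0) (shiftF-sub c) vars
  where
  vars : shiftσ (suc c) ⊙ shiftσ 0 ≗ shiftσ 0 ⊙ shiftσ c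
  vars n with n <ᵇ c
  ... | true  = refl
  ... | false = refl

shiftF-[0:=] : ∀ c t (A : Formula Ω) →
  shiftF c (A [0:= t ]) ≡ shiftF (suc c) A [0:= shiftT c t ]
shiftF-[0:=] c t = composites-agree
  (shiftF-sub c) (substF-sub 0 t) (substF-sub 0 (shiftT c t)) (shiftF-sub (suc c)) vars
  where
  vars : shiftσ c ⊙ substσ 0 t ≗ substσ 0 (shiftT c t) ⊙ shiftσ (suc c)
  vars zero = sym (shiftT-sub c t)
  vars (suc n) with n <ᵇ c
  ... | true  = refl
  ... | false = refl

substF-shiftF : ∀ k t (A : Formula Ω) →
  substF (suc k) (shiftT 0 t) (shiftF 0 A) ≡ shiftF 0 (substF k t A)
substF-shiftF k t = composites-agree
  (substF-sub (suc k) (shiftT 0 t)) (shiftF-sub 0) (shiftF-sub 0) (substF-sub k t) vars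
  where
  vars : substσ (suc k) (shiftT 0 t) ⊙ shiftσ 0 ≗ shiftσ 0 ⊙ substσ k t
  vars n = trans (sym (lift-substσ k t (suc n))) (shiftT-sub 0 (substσ k t n))

substF-[0:=] : ∀ k t s (A : Formula Ω) →
  substF k t (A [0:= s ]) ≡ substF (suc k) (shiftT 0 t) A [0:= substT k t s ]
substF-[0:=] k t s = composites-agree
  (substF-sub k t) (substF-sub 0 s) (substF-sub 0 (substT k t s)) (substF-sub (suc k) (shiftT 0 t)) (vars k)
  where
  substσ-shiftT : ∀ u → subT (substσ 0 u) (shiftT 0 t) ≡ t
  substσ-shiftT u = begin
    subT (substσ 0 u) (shiftT 0 t)            ≡⟨ cong (subT (substσ 0 u)) (shiftT-sub 0 t) ⟩
    subT (substσ 0 u) (subT (shiftσ 0) t)     ≡⟨ subT-⊙ (substσ 0 u) (shiftσ 0) t ⟩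
    subT (substσ 0 u ⊙ shiftσ 0) t            ≡⟨ subT-cong (λ _ → refl) t ⟩
    subT var t                                ≡⟨ subT-var t ⟩
    t                                         ∎
    where open ≡-Reasoning

  vars : ∀ k → substσ k t ⊙ substσ 0 s ≗ substσ 0 (substT k t s) ⊙ substσ (suc k) (shiftT 0 t)
  vars k       zero                = sym (substT-sub k t s)
  vars zero    (suc zero)          = sym (substσ-shiftT _)
  vars (suc k) (suc zero)          = refl
  vars zero    (suc (suc n))       = refl
  vars (suc k) (suc (suc n)) with n <ᵇ k | n ≡ᵇ k
  ... | true  | _     = refl
  ... | false | true  = sym (substσ-shiftT _)
  ... | false | false = refl

[0:=]-shiftF : ∀ t (A : Formula Ω) → shiftF 0 A [0:= t ] ≡ A
[0:=]-shiftF t = composite-id (substF-sub 0 t) (shiftF-sub 0) (λ _ → refl)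

[0:=var0]-shiftF1 : (A : Formula Ω) → shiftF 1 A [0:= var 0 ] ≡ A
[0:=var0]-shiftF1 = composite-id (substF-sub 0 (var 0)) (shiftF-sub 1) vars
  where
  vars : substσ 0 (var 0) ⊙ shiftσ 1 ≗ var
  vars zero    = refl
  vars (suc n) = refl

depth : Formula Ω → ℕ
depth (atom p ts)  = 0
depth (neg f A)    = suc (depth A)
depth (conj U A B) = suc (depth A ⊔ depth B)
depth (all U A)    = suc (depth A)

depth-subF : ∀ σ (A : Formula Ω) → depth (subF σ A) ≡ depth A
depth-subF σ (atom p ts)  = refl
depth-subF σ (neg f A)    = cong suc (depth-subF σ A)
depth-subF σ (conj U A B) = cong₂ (λ m n → suc (m ⊔ n)) (depth-subF σ A) (depth-subF σ B)
depth-subF σ (all U A)    = cong suc (depth-subF (lift σ) A)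

depth-shiftF : ∀ c (A : Formula Ω) → depth (shiftF c A) ≡ depth A
depth-shiftF c A = trans (cong depth (shiftF-sub c A)) (depth-subF _ A)

depth-[0:=] : ∀ t (A : Formula Ω) → depth (A [0:= t ]) ≡ depth A
depth-[0:=] t A = trans (cong depth (substF-sub 0 t A)) (depth-subF _ A)

mapFormula : (Formula Ω → Formula Ω) → IFormula Ω → IFormula Ω
mapFormula F (R ⟨ A ⟩) = R ⟨ F A ⟩

map-mapFormula-comm : ∀ {F G F′ G′ : Formula Ω → Formula Ω} →
  (∀ A → F (G A) ≡ F′ (G′ A)) →
  ∀ Γ → map (mapFormula F) (map (mapFormula G) Γ) ≡ map (mapFormula F′) (map (mapFormula G′) Γ)
map-mapFormula-comm eq []              = refl
map-mapFormula-comm eq ((R ⟨ A ⟩) ∷ Γ) =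
  cong₂ _∷_ (cong (R ⟨_⟩) (eq A)) (map-mapFormula-comm eq Γ)

map-mapFormula-cancel : ∀ {F G : Formula Ω → Formula Ω} → (∀ A → F (G A) ≡ A) →
  ∀ Γ → map (mapFormula F) (map (mapFormula G) Γ) ≡ Γ
map-mapFormula-cancel eq []              = refl
map-mapFormula-cancel eq ((R ⟨ A ⟩) ∷ Γ) =
  cong₂ _∷_ (cong (R ⟨_⟩) (eq A)) (map-mapFormula-cancel eq Γ)

-- For c = 0 the conclusion is definitionally ⊢ shiftSeq Γ.
⊢-shift : ∀ c → ⊢ Γ → ⊢ map (mapFormula (shiftF c)) Γ
⊢-shift c (Id Rs p ts part) = subst ⊢_ (map-∘ Rs) (Id Rs p (shiftTs c ts) part)
⊢-shift c (Exch π d)        = Exch (map⁺ _ π) (⊢-shift c d)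
⊢-shift c (Weaken R A d)    = Weaken R (shiftF c A) (⊢-shift c d)
⊢-shift c (Contract d)      = Contract (⊢-shift c d)
⊢-shift c (Neg d)           = Neg (⊢-shift c d)
⊢-shift c (AndNegL u∉ d)    = AndNegL u∉ (⊢-shift c d)
⊢-shift c (AndNegR u∉ d)    = AndNegR u∉ (⊢-shift c d)
⊢-shift c (AndPos u d e)    = AndPos u (⊢-shift c d) (⊢-shift c e)
⊢-shift c (AllNeg {R = R} {A = A} t u∉ d) =
  AllNeg (shiftT c t) u∉ (subst (λ B → ⊢ (R ⟨ B ⟩ ∷ _)) (shiftF-[0:=] c t A) (⊢-shift c d))
⊢-shift c (AllPos {Γ} {R} {A = A} u d) =
  AllPos u (subst (λ Δ → ⊢ (R ⟨ shiftF (suc c) A ⟩ ∷ Δ))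
                  (map-mapFormula-comm (shiftF-shiftF c) Γ) (⊢-shift (suc c) d))

⊢-subst : ∀ k t → ⊢ Γ → ⊢ map (mapFormula (substF k t)) Γ
⊢-subst k t (Id Rs p ts part) = subst ⊢_ (map-∘ Rs) (Id Rs p (substTs k t ts) part)
⊢-subst k t (Exch π d)        = Exch (map⁺ _ π) (⊢-subst k t d)
⊢-subst k t (Weaken R A d)    = Weaken R (substF k t A) (⊢-subst k t d)
⊢-subst k t (Contract d)      = Contract (⊢-subst k t d)
⊢-subst k t (Neg d)           = Neg (⊢-subst k t d)
⊢-subst k t (AndNegL u∉ d)    = AndNegL u∉ (⊢-subst k t d)
⊢-subst k t (AndNegR u∉ d)    = AndNegR u∉ (⊢-subst k t d)
⊢-subst k t (AndPos u d e)    = AndPos u (⊢-subst k t d) (⊢-subst k t e)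
⊢-subst k t (AllNeg {R = R} {A = A} s u∉ d) =
  AllNeg (substT k t s) u∉
    (subst (λ B → ⊢ (R ⟨ B ⟩ ∷ _)) (substF-[0:=] k t s A) (⊢-subst k t d))
⊢-subst k t (AllPos {Γ} {R} {A = A} u d) =
  AllPos u (subst (λ Δ → ⊢ (R ⟨ substF (suc k) (shiftT 0 t) A ⟩ ∷ Δ))
                  (map-mapFormula-comm (substF-shiftF k t) Γ)
                  (⊢-subst (suc k) (shiftT 0 t) d))

⊢-weakenˡ : ∀ Δ → ⊢ Γ → ⊢ (Δ ++ Γ)
⊢-weakenˡ []              d = d
⊢-weakenˡ ((R ⟨ A ⟩) ∷ Δ) d = Weaken R A (⊢-weakenˡ Δ d)

⊢-contractˡ : ∀ Δ → ⊢ (Δ ++ Δ ++ Γ) → ⊢ (Δ ++ Γ)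
⊢-contractˡ []      d = d
⊢-contractˡ {Γ = Γ} (x ∷ Δ) d =
  Exch (shift x Δ Γ) (⊢-contractˡ Δ (Exch (↭-sym x-to-front) x-contracted))
  where
  x-contracted : ⊢ (x ∷ Δ ++ Δ ++ Γ)
  x-contracted = Contract (Exch (prep x (shift x Δ (Δ ++ Γ))) d)
  x-to-front : Δ ++ Δ ++ x ∷ Γ ↭ x ∷ Δ ++ Δ ++ Γ
  x-to-front = ↭-trans (++⁺ˡ Δ (shift x Δ Γ)) (shift x Δ (Δ ++ Γ))

prependCopies : {X : Set a} → ℕ → List X → List X → List X
prependCopies zero    O Γ = Γ
prependCopies (suc n) O Γ = O ++ prependCopies n O Γ

prependCopies-∷ : {X : Set a} {x : X} {O Γ : List X} → ∀ n →
  prependCopies n O (x ∷ Γ) ↭ x ∷ prependCopies n O Γ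
prependCopies-∷ zero = ↭-refl
prependCopies-∷ {x = x} {O} {Γ} (suc n) =
  ↭-trans (++⁺ˡ O (prependCopies-∷ n)) (shift x O (prependCopies n O Γ))

prependCopies⁺ : {X : Set a} {O Γ Γ′ : List X} → ∀ n → Γ ↭ Γ′ →
  prependCopies n O Γ ↭ prependCopies n O Γ′
prependCopies⁺ zero        π = π
prependCopies⁺ {O = O} (suc n) π = ++⁺ˡ O (prependCopies⁺ n π)

map-prependCopies : {X : Set a} {Y : Set b} (f : X → Y) → ∀ n O Γ →
  map f (prependCopies n O Γ) ≡ prependCopies n (map f O) (map f Γ)
map-prependCopies f zero    O Γ = refl
map-prependCopies f (suc n) O Γ =
  trans (map-++ f O _) (cong (map f O ++_) (map-prependCopies f n O Γ))

⊢-prependCopies : ∀ {O} n → ⊢ (O ++ Γ) → ⊢ prependCopies (suc n) O Γ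
⊢-prependCopies         zero    d = d
⊢-prependCopies {O = O} (suc n) d = ⊢-weakenˡ O (⊢-prependCopies n d)

-- Partitions by counting

indicator : Bool → ℕ
indicator true  = 1
indicator false = 0

multiplicity : Ω → List (RoleSet Ω) → ℕ
multiplicity r Rs = sum (map (λ R → indicator (R r)) Rs)

PartitionOf : List (RoleSet Ω) → RoleSet Ω → Set
PartitionOf Rs S = ∀ r → multiplicity r Rs ≡ indicator (S r)

Partition : List (RoleSet Ω) → Set
Partition Rs = PartitionOf Rs Full

multiplicity-++ : ∀ (r : Ω) Rs Qs →
  multiplicity r (Rs ++ Qs) ≡ multiplicity r Rs + multiplicity r Qs
multiplicity-++ r Rs Qs = trans (cong sum (map-++ ι Rs Qs)) (sum-++ (map ι Rs) (map ι Qs))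
  where ι = λ (R : RoleSet _) → indicator (R r)

multiplicity-↭ : ∀ (r : Ω) → Rs ↭ Qs → multiplicity r Rs ≡ multiplicity r Qs
multiplicity-↭ r π = sum-↭ (map⁺ _ π)

multiplicity-replicate : ∀ (r : Ω) n R → multiplicity r (replicate n R) ≡ n * indicator (R r)
multiplicity-replicate r zero    R = refl
multiplicity-replicate r (suc n) R = cong (indicator (R r) +_) (multiplicity-replicate r n R)

multiplicity-prependCopies : ∀ (r : Ω) n M Ps →
  multiplicity r (prependCopies n M Ps) ≡ n * multiplicity r M + multiplicity r Ps
multiplicity-prependCopies r zero    M Ps = refl
multiplicity-prependCopies r (suc n) M Ps =
  trans (multiplicity-++ r M _)
        (trans (cong (multiplicity r M +_) (multiplicity-prependCopies r n M Ps))
               (sym (+-assoc (multiplicity r M) _ _)))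

PartitionOf-↭ : Rs ↭ Qs → PartitionOf Rs S → PartitionOf Qs S
PartitionOf-↭ π part r = trans (sym (multiplicity-↭ r π)) (part r)

PartitionOf-prependCopies : PartitionOf M S → PartitionOf (replicate n S ++ Ps) R →
  PartitionOf (prependCopies n M Ps) R
PartitionOf-prependCopies {M = M} {S = S} {n = n} {Ps = Ps} {R = R} M-part part r = begin
  multiplicity r (prependCopies n M Ps)               ≡⟨ multiplicity-prependCopies r n M Ps ⟩
  n * multiplicity r M + multiplicity r Ps
    ≡⟨ cong (λ m → n * m + multiplicity r Ps) (M-part r) ⟩
  n * indicator (S r) + multiplicity r Ps
    ≡⟨ cong (_+ multiplicity r Ps) (sym (multiplicity-replicate r n S)) ⟩
  multiplicity r (replicate n S) + multiplicity r Ps  ≡⟨ sym (multiplicity-++ r (replicate n S) Ps) ⟩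
  multiplicity r (replicate n S ++ Ps)                ≡⟨ part r ⟩
  indicator (R r)                                     ∎
  where open ≡-Reasoning

∉⇒multiplicity≡0 : ∀ (r : Ω) Rs → (∀ i → lookup Rs i r ≢ true) → multiplicity r Rs ≡ 0
∉⇒multiplicity≡0 r []       ∉ = refl
∉⇒multiplicity≡0 r (R ∷ Rs) ∉ with R r in Rr
... | true  = ⊥-elim (∉ fzero Rr)
... | false = ∉⇒multiplicity≡0 r Rs (∉ ∘ fsuc)

multiplicity≡0⇒∉ : ∀ (r : Ω) Rs → multiplicity r Rs ≡ 0 → ∀ i → lookup Rs i r ≢ true
multiplicity≡0⇒∉ r (R ∷ Rs) m≡0 fzero    Rr with R r
multiplicity≡0⇒∉ r (R ∷ Rs) () fzero refl | true
multiplicity≡0⇒∉ r (R ∷ Rs) m≡0 (fsuc i) Rᵢr with R r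
... | false = multiplicity≡0⇒∉ r Rs m≡0 i Rᵢr

multiplicity-tail : ∀ (r : Ω) R Rs →
  multiplicity r (R ∷ Rs) ≡ 1 → R r ≡ true → multiplicity r Rs ≡ 0
multiplicity-tail r R Rs m≡1 Rr rewrite Rr = suc-injective m≡1

isPartition⇒Partition : IsPartition Rs → Partition Rs
isPartition⇒Partition {Rs = Rs} (covered , unique) r = exactly-one Rs (covered r) (unique r)
  where
  exactly-one : ∀ Rs → Σ (Fin (length Rs)) (λ i → lookup Rs i r ≡ true) →
    (∀ i j → lookup Rs i r ≡ true → lookup Rs j r ≡ true → i ≡ j) → multiplicity r Rs ≡ 1
  exactly-one (R ∷ Rs) (i , Rᵢr) unique with R r in Rr | i
  ... | true  | _      =
    cong suc (∉⇒multiplicity≡0 r Rs (λ j Rⱼr → Fin.0≢1+n (unique fzero (fsuc j) Rr Rⱼr)))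
  ... | false | fzero  with () ← trans (sym Rr) Rᵢr
  ... | false | fsuc i =
    exactly-one Rs (i , Rᵢr)
      (λ i j Rᵢr Rⱼr → Fin.suc-injective (unique (fsuc i) (fsuc j) Rᵢr Rⱼr))

Partition⇒isPartition : Partition Rs → IsPartition Rs
Partition⇒isPartition {Rs = Rs} part = (λ r → witness r Rs (part r)) , (λ r → unique r Rs (part r))
  where
  witness : ∀ r Rs → multiplicity r Rs ≡ 1 → Σ (Fin (length Rs)) (λ i → lookup Rs i r ≡ true)
  witness r (R ∷ Rs) m≡1 with R r in Rr
  ... | true  = fzero , Rr
  ... | false with i , Rᵢr ← witness r Rs m≡1 = fsuc i , Rᵢr

  unique : ∀ r Rs → multiplicity r Rs ≡ 1 →
    ∀ i j → lookup Rs i r ≡ true → lookup Rs j r ≡ true → i ≡ j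
  unique r (R ∷ Rs) m≡1 fzero    fzero    _   _   = refl
  unique r (R ∷ Rs) m≡1 fzero    (fsuc j) Rr  Rⱼr =
    ⊥-elim (multiplicity≡0⇒∉ r Rs (multiplicity-tail r R Rs m≡1 Rr) j Rⱼr)
  unique r (R ∷ Rs) m≡1 (fsuc i) fzero    Rᵢr Rr  =
    ⊥-elim (multiplicity≡0⇒∉ r Rs (multiplicity-tail r R Rs m≡1 Rr) i Rᵢr)
  unique r (R ∷ Rs) m≡1 (fsuc i) (fsuc j) Rᵢr Rⱼr with R r in Rr
  ... | true  = ⊥-elim (multiplicity≡0⇒∉ r Rs (suc-injective m≡1) i Rᵢr)
  ... | false = cong fsuc (unique r Rs m≡1 i j Rᵢr Rⱼr)

-- Replacing every tracked occurrence of a formula in a derivation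

data HeadView {X : Set a} (x X₀ : X) (Θ Γ : List X) : ℕ → Set a where
  tracked   : ∀ {k} → x ≡ X₀ → Θ ↭ replicate k X₀ ++ Γ → HeadView x X₀ Θ Γ (suc k)
  untracked : ∀ {n} Γ′ → Γ ↭ x ∷ Γ′ → Θ ↭ replicate n X₀ ++ Γ′ → HeadView x X₀ Θ Γ n

headView : {X : Set a} {x X₀ : X} {Θ : List X} → ∀ n Γ →
  x ∷ Θ ↭ replicate n X₀ ++ Γ → HeadView x X₀ Θ Γ n
headView {X₀ = X₀} n Γ π with ∈-++⁻ (replicate n X₀) (∈-resp-↭ π (here refl))
headView zero    Γ π | inj₁ ()
headView {X₀ = X₀} (suc k) Γ π | inj₁ x∈X₀s
  with refl ← All.lookup (replicate⁺ {P = _≡ X₀} (suc k) refl) x∈X₀s =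
  tracked refl (drop-∷ π)
headView {x = x} {X₀} n Γ π | inj₂ x∈Γ with Γ₁ , Γ₂ , refl ← ∈-∃++ x∈Γ =
  untracked (Γ₁ ++ Γ₂) (shift x Γ₁ Γ₂) (drop-∷ (↭-trans π x-to-front))
  where
  x-to-front : replicate n X₀ ++ Γ₁ ++ x ∷ Γ₂ ↭ x ∷ replicate n X₀ ++ Γ₁ ++ Γ₂
  x-to-front =
    ↭-trans (++⁺ˡ (replicate n X₀) (shift x Γ₁ Γ₂)) (shift x (replicate n X₀) (Γ₁ ++ Γ₂))

↭-insert : {X : Set a} {y : X} {Θ L Γ : List X} → Θ ↭ L ++ Γ → y ∷ Θ ↭ L ++ y ∷ Γ
↭-insert {y = y} {L = L} {Γ} π = ↭-trans (prep y π) (↭-sym (shift y L Γ))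

shiftSeq-↭ : ∀ {X : IFormula Ω} {Δ Γ} → Δ ↭ replicate n X ++ Γ →
  shiftSeq Δ ↭ replicate n (mapFormula (shiftF 0) X) ++ shiftSeq Γ
shiftSeq-↭ {n = n} {X = X} {Γ = Γ} π =
  ↭-trans (map⁺ _ π)
    (↭-reflexive (trans (map-++ _ (replicate n X) Γ) (cong (_++ shiftSeq Γ) (map-replicate _ n X))))

data Premises (S : RoleSet Ω) : Formula Ω → Sequent Ω → Set₁ where
  byNeg     : ∀ {f B Λ} → ⊢ (preimage f S ⟨ B ⟩ ∷ Λ) → Premises S (neg f B) Λ
  byAndNegL : ∀ {U B C Λ} → ¬ (U ∈U) S → ⊢ (S ⟨ B ⟩ ∷ Λ) → Premises S (conj U B C) Λ
  byAndNegR : ∀ {U B C Λ} → ¬ (U ∈U) S → ⊢ (S ⟨ C ⟩ ∷ Λ) → Premises S (conj U B C) Λ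
  byAndPos  : ∀ {U B C Λ} → (U ∈U) S → ⊢ (S ⟨ B ⟩ ∷ Λ) → ⊢ (S ⟨ C ⟩ ∷ Λ) →
              Premises S (conj U B C) Λ
  byAllNeg  : ∀ {U B Λ} t → ¬ (U ∈U) S → ⊢ (S ⟨ B [0:= t ] ⟩ ∷ Λ) → Premises S (all U B) Λ
  byAllPos  : ∀ {U B Λ} → (U ∈U) S → ⊢ (S ⟨ B ⟩ ∷ shiftSeq Λ) → Premises S (all U B) Λ

-- P A O says that each tracked occurrence of S ⟨ A ⟩ is to be replaced by the
-- sequent O; at-axiom and at-rule do so where a tracked occurrence is principal.
record Replacement (S : RoleSet Ω) (P : Formula Ω → Sequent Ω → Set₁) : Set₁ where
  field
    under-shift : ∀ {A O} → P A O → P (shiftF 0 A) (shiftSeq O)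
    at-axiom    : ∀ {p ts O k Ps} → P (atom p ts) O → Partition (replicate (suc k) S ++ Ps) →
                  ⊢ prependCopies (suc k) O (map (_⟨ atom p ts ⟩) Ps)
    at-rule     : ∀ {A O Λ} → P A O → Premises S A Λ → ⊢ (O ++ Λ)

data AxiomView (S : RoleSet Ω) (k : ℕ) (a : Formula Ω) : Formula Ω → Sequent Ω → Set₁ where
  atomic : ∀ Ps → Partition (replicate (suc k) S ++ Ps) → AxiomView S k a a (map (_⟨ a ⟩) Ps)

axiom-formulas : ∀ {Θ} → map (_⟨ A ⟩) Rs ↭ Θ → All (λ x → IFormula.formula x ≡ A) Θ
axiom-formulas π =
  All.tabulate λ x∈Θ →
    cong IFormula.formula (proj₂ (proj₂ (∈-map⁻ _ (∈-resp-↭ (↭-sym π) x∈Θ))))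

atomic-roles : All (λ x → IFormula.formula x ≡ A) Γ → map (_⟨ A ⟩) (map IFormula.roles Γ) ≡ Γ
atomic-roles []                      = refl
atomic-roles {Γ = x ∷ Γ} (x≡A ∷ Γ≡A) =
  cong₂ _∷_ (cong (IFormula.roles x ⟨_⟩) (sym x≡A)) (atomic-roles Γ≡A)

roles-↭ : ∀ {X} → map (_⟨ A ⟩) Rs ↭ replicate n X ++ Γ →
  Rs ↭ replicate n (IFormula.roles X) ++ map IFormula.roles Γ
roles-↭ {Rs = Rs} {n = n} {Γ = Γ} {X} π =
  subst₂ _↭_ (trans (sym (map-∘ Rs)) (map-id Rs))
    (trans (map-++ _ (replicate n X) Γ) (cong (_++ _) (map-replicate _ n X)))
    (map⁺ IFormula.roles π)

axiomView : IsPartition Rs → map (_⟨ atom p ts ⟩) Rs ↭ replicate (suc k) (S ⟨ A ⟩) ++ Γ →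
  AxiomView S k (atom p ts) A Γ
axiomView {Rs = Rs} {k = k} {S = S} {Γ = Γ} part π with refl ∷ Γ-atomic ← axiom-formulas π =
  subst (AxiomView S k _ _) (atomic-roles (++⁻ʳ (replicate k _) Γ-atomic))
    (atomic (map IFormula.roles Γ)
            (PartitionOf-↭ (roles-↭ {n = suc k} π) (isPartition⇒Partition {Rs = Rs} part)))

module _ {S : RoleSet Ω} {P : Formula Ω → Sequent Ω → Set₁} (h : Replacement S P) where
  open Replacement h

  private
    restore : ∀ {O Γ Γ′} {y : IFormula Ω} n → Γ ↭ y ∷ Γ′ →
      ⊢ (y ∷ prependCopies n O Γ′) → ⊢ prependCopies n O Γ
    restore n γ = Exch (↭-trans (↭-sym (prependCopies-∷ n)) (prependCopies⁺ n (↭-sym γ)))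

  mutual
    replace : ∀ {Θ A O} n Γ → ⊢ Θ → P A O →
      Θ ↭ replicate n (S ⟨ A ⟩) ++ Γ → ⊢ prependCopies n O Γ
    replace zero    Γ (Id Rs p ts part) _ π = Exch π (Id Rs p ts part)
    replace (suc k) Γ (Id Rs p ts part) w π with axiomView {k = k} {Γ = Γ} part π
    ... | atomic Ps part′ = at-axiom {k = k} {Ps = Ps} w part′
    replace n Γ (Exch σ d) w π = replace n Γ d w (↭-trans σ π)
    replace n Γ (Weaken R B d) w π with headView n Γ π
    ... | tracked refl π′     = ⊢-weakenˡ _ (replace _ Γ d w π′)
    ... | untracked Γ′ γ π′   = restore n γ (Weaken R B (replace n Γ′ d w π′))
    replace {O = O} n Γ (Contract d) w π with headView n Γ π
    ... | tracked refl π′     = ⊢-contractˡ O (replace _ Γ d w (prep _ (prep _ π′)))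
    ... | untracked Γ′ γ π′   =
      restore n γ (Contract (Exch (prep _ (prependCopies-∷ n)) (premise n _ d w (↭-insert π′))))
    replace n Γ (Neg d) w π with headView n Γ π
    ... | tracked refl π′     = at-rule w (byNeg (premise _ Γ d w π′))
    ... | untracked Γ′ γ π′   = restore n γ (Neg (premise n Γ′ d w π′))
    replace n Γ (AndNegL u∉ d) w π with headView n Γ π
    ... | tracked refl π′     = at-rule w (byAndNegL u∉ (premise _ Γ d w π′))
    ... | untracked Γ′ γ π′   = restore n γ (AndNegL u∉ (premise n Γ′ d w π′))
    replace n Γ (AndNegR u∉ d) w π with headView n Γ π
    ... | tracked refl π′     = at-rule w (byAndNegR u∉ (premise _ Γ d w π′))
    ... | untracked Γ′ γ π′   = restore n γ (AndNegR u∉ (premise n Γ′ d w π′))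
    replace n Γ (AndPos u d e) w π with headView n Γ π
    ... | tracked refl π′     = at-rule w (byAndPos u (premise _ Γ d w π′) (premise _ Γ e w π′))
    ... | untracked Γ′ γ π′   =
      restore n γ (AndPos u (premise n Γ′ d w π′) (premise n Γ′ e w π′))
    replace n Γ (AllNeg t u∉ d) w π with headView n Γ π
    ... | tracked refl π′     = at-rule w (byAllNeg t u∉ (premise _ Γ d w π′))
    ... | untracked Γ′ γ π′   = restore n γ (AllNeg t u∉ (premise n Γ′ d w π′))
    replace n Γ (AllPos u d) w π with headView n Γ π
    ... | tracked refl π′     = at-rule w (byAllPos u (premise-shifted _ Γ d w π′))
    ... | untracked Γ′ γ π′   = restore n γ (AllPos u (premise-shifted n Γ′ d w π′))

    premise : ∀ {y Δ A O} n Γ → ⊢ (y ∷ Δ) → P A O → Δ ↭ replicate n (S ⟨ A ⟩) ++ Γ →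
      ⊢ (y ∷ prependCopies n O Γ)
    premise n Γ d w π = Exch (prependCopies-∷ n) (replace n _ d w (↭-insert π))

    premise-shifted : ∀ {y Δ A O} n Γ → ⊢ (y ∷ shiftSeq Δ) → P A O →
      Δ ↭ replicate n (S ⟨ A ⟩) ++ Γ → ⊢ (y ∷ shiftSeq (prependCopies n O Γ))
    premise-shifted {y = y} {O = O} n Γ d w π =
      subst (λ Δ → ⊢ (y ∷ Δ)) (sym (map-prependCopies _ n O Γ))
        (premise n (shiftSeq Γ) d (under-shift w) (shiftSeq-↭ {n = n} π))

  replace₁ : ∀ {A O Γ} → P A O → ⊢ (S ⟨ A ⟩ ∷ Γ) → ⊢ (O ++ Γ)
  replace₁ w d = replace 1 _ d w ↭-refl

module _ {S : RoleSet Ω} {f : Ω → Ω} where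
  data NegInversion : Formula Ω → Sequent Ω → Set₁ where
    negInv : ∀ B → NegInversion (neg f B) (preimage f S ⟨ B ⟩ ∷ [])

  neg-inversion : Replacement S NegInversion
  neg-inversion = record
    { under-shift = λ { (negInv B) → negInv (shiftF 0 B) }
    ; at-axiom    = λ ()
    ; at-rule     = λ { (negInv B) (byNeg d) → d }
    }

  Neg-invert : ⊢ (S ⟨ neg f B ⟩ ∷ Γ) → ⊢ (preimage f S ⟨ B ⟩ ∷ Γ)
  Neg-invert = replace₁ neg-inversion (negInv _)

module _ {S : RoleSet Ω} {U : Ultrafilter Ω} (u : (U ∈U) S) where
  data AndInversion : Formula Ω → Sequent Ω → Set₁ where
    left  : ∀ B C → AndInversion (conj U B C) (S ⟨ B ⟩ ∷ [])
    right : ∀ B C → AndInversion (conj U B C) (S ⟨ C ⟩ ∷ [])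

  and-inversion : Replacement S AndInversion
  and-inversion = record
    { under-shift = λ { (left B C) → left _ _ ; (right B C) → right _ _ }
    ; at-axiom    = λ ()
    ; at-rule     = λ where
        (left _ _)  (byAndPos _ d _)  → d
        (right _ _) (byAndPos _ _ e)  → e
        (left _ _)  (byAndNegL u∉ _) → ⊥-elim (u∉ u)
        (left _ _)  (byAndNegR u∉ _) → ⊥-elim (u∉ u)
        (right _ _) (byAndNegL u∉ _) → ⊥-elim (u∉ u)
        (right _ _) (byAndNegR u∉ _) → ⊥-elim (u∉ u)
    }

  AndPos-invertˡ : ∀ {C} → ⊢ (S ⟨ conj U B C ⟩ ∷ Γ) → ⊢ (S ⟨ B ⟩ ∷ Γ)
  AndPos-invertˡ = replace₁ and-inversion (left _ _)

  AndPos-invertʳ : ∀ {C} → ⊢ (S ⟨ conj U B C ⟩ ∷ Γ) → ⊢ (S ⟨ C ⟩ ∷ Γ)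
  AndPos-invertʳ = replace₁ and-inversion (right _ _)

  data AllInstance : Formula Ω → Sequent Ω → Set₁ where
    inst : ∀ B t → AllInstance (all U B) (S ⟨ B [0:= t ] ⟩ ∷ [])

  all-inversion : Replacement S AllInstance
  all-inversion = record
    { under-shift = λ { (inst B t) →
        subst (λ C → AllInstance _ (S ⟨ C ⟩ ∷ [])) (sym (shiftF-[0:=] 0 t B))
              (inst (shiftF 1 B) (shiftT 0 t)) }
    ; at-axiom    = λ ()
    ; at-rule     = λ where
        (inst B t) (byAllPos {Λ = Λ} _ d) →
          subst (λ Λ → ⊢ (S ⟨ B [0:= t ] ⟩ ∷ Λ)) (map-mapFormula-cancel ([0:=]-shiftF t) Λ)
                (⊢-subst 0 t d)
        (inst _ _) (byAllNeg _ u∉ _) → ⊥-elim (u∉ u)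
    }

  AllPos-instantiate : ∀ t → ⊢ (S ⟨ all U B ⟩ ∷ Γ) → ⊢ (S ⟨ B [0:= t ] ⟩ ∷ Γ)
  AllPos-instantiate t = replace₁ all-inversion (inst _ t)

  AllPos-invert : ⊢ (S ⟨ all U B ⟩ ∷ Γ) → ⊢ (S ⟨ B ⟩ ∷ shiftSeq Γ)
  AllPos-invert {B = B} {Γ = Γ} d =
    subst (λ C → ⊢ (S ⟨ C ⟩ ∷ shiftSeq Γ)) ([0:=var0]-shiftF1 B)
          (AllPos-instantiate (var 0) (⊢-shift 0 d))

Meet : RoleSet Ω → RoleSet Ω → RoleSet Ω → Set
Meet T R₁ R₂ = ∀ r → T r ≡ R₁ r ∧ R₂ r

Cover : RoleSet Ω → RoleSet Ω → Set
Cover R₁ R₂ = ∀ r → R₁ r ≡ false → R₂ r ≡ false → ⊥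

Meet-comm : Meet T R₁ R₂ → Meet T R₂ R₁
Meet-comm {R₁ = R₁} {R₂ = R₂} meet r = trans (meet r) (∧-comm (R₁ r) (R₂ r))

Cover-comm : Cover R₁ R₂ → Cover R₂ R₁
Cover-comm cover r R₂r R₁r = cover r R₁r R₂r

-- The conclusion may use any T pointwise equal to R₁ ∩ R₂, which makes the
-- statement symmetric in R₁ and R₂ (∩ is not definitionally commutative).
Cut : Formula Ω → Set₁
Cut {Ω} A = ∀ {R₁ R₂ T : RoleSet Ω} {Γ₁ Γ₂} → Meet T R₁ R₂ → Cover R₁ R₂ →
  ⊢ (R₁ ⟨ A ⟩ ∷ Γ₁) → ⊢ (R₂ ⟨ A ⟩ ∷ Γ₂) → ⊢ (T ⟨ A ⟩ ∷ Γ₁ ++ Γ₂)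

∈U-meet : ∀ (U : Ultrafilter Ω) → Meet T R₁ R₂ → (U ∈U) R₁ → (U ∈U) R₂ → (U ∈U) T
∈U-meet U meet u₁ u₂ = upward U (λ r R₁R₂r → trans (meet r) R₁R₂r) (inter U u₁ u₂)

∉U-meet : ∀ (U : Ultrafilter Ω) → Meet T R₁ R₂ → ¬ (U ∈U) R₂ → ¬ (U ∈U) T
∉U-meet U meet u∉ t∈ = u∉ (upward U (λ r Tr → ∧-conicalʳ _ _ (trans (sym (meet r)) Tr)) t∈)

∈U-cover : ∀ (U : Ultrafilter Ω) → Cover R₁ R₂ → (U ∈U) R₁ ⊎ (U ∈U) R₂
∈U-cover {R₁ = R₁} {R₂ = R₂} U cover with ultra U R₁
... | inj₁ u₁  = inj₁ u₁
... | inj₂ u∁₁ = inj₂ (upward U ∁R₁⊆R₂ u∁₁)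
  where
  ∁R₁⊆R₂ : ∁ R₁ ⊆ R₂
  ∁R₁⊆R₂ r ∁R₁r with R₁ r in R₁r | R₂ r in R₂r
  ... | false | true  = refl
  ... | false | false = ⊥-elim (cover r R₁r R₂r)

module _ {S : RoleSet Ω} {M : List (RoleSet Ω)} (M-part : PartitionOf M S) where
  data AtomSplit : Formula Ω → Sequent Ω → Set₁ where
    atomSplit : ∀ p ts → AtomSplit (atom p ts) (map (_⟨ atom p ts ⟩) M)

  atom-split : Replacement S AtomSplit
  atom-split = record
    { under-shift = λ { (atomSplit p ts) → subst (AtomSplit _) (map-∘ M) (atomSplit p (shiftTs 0 ts)) }
    ; at-axiom    = λ { {k = k} {Ps} (atomSplit p ts) part →
        subst ⊢_ (map-prependCopies _ (suc k) M Ps)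
          (Id (prependCopies (suc k) M Ps) p ts
              (Partition⇒isPartition {Rs = prependCopies (suc k) M Ps}
                 (PartitionOf-prependCopies {M = M} {n = suc k} {Ps = Ps} M-part part))) }
    ; at-rule     = λ { (atomSplit _ _) () }
    }

  ⊢-split-atom : ⊢ (S ⟨ atom p ts ⟩ ∷ Γ) → ⊢ (map (_⟨ atom p ts ⟩) M ++ Γ)
  ⊢-split-atom = replace₁ atom-split (atomSplit _ _)

meet-indicator : ∀ b₁ b₂ k m → (b₁ ≡ false → b₂ ≡ false → ⊥) →
  suc k * indicator b₁ + m ≡ 1 → indicator (b₁ ∧ b₂) + m ≡ indicator b₂
meet-indicator true  true  zero    zero    _     _ = refl
meet-indicator true  false zero    zero    _     _ = refl
meet-indicator true  _     zero    (suc m) _     ()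
meet-indicator true  _     (suc k) m       _     ()
meet-indicator false true  k       m       _     e = trans (cong (_+ m) (sym (*-zeroʳ (suc k)))) e
meet-indicator false false _       _       cover _ = ⊥-elim (cover refl refl)

module _ {R₁ R₂ T : RoleSet Ω} (meet : Meet T R₁ R₂) (cover : Cover R₁ R₂) where
  meet-PartitionOf : Partition (replicate (suc k) R₁ ++ Ps) → PartitionOf (T ∷ Ps) R₂
  meet-PartitionOf {k = k} {Ps = Ps} part r =
    trans (cong (λ b → indicator b + multiplicity r Ps) (meet r))
          (meet-indicator (R₁ r) (R₂ r) k _ (cover r) count)
    where
    count : suc k * indicator (R₁ r) + multiplicity r Ps ≡ 1
    count = trans (cong (_+ multiplicity r Ps) (sym (multiplicity-replicate r (suc k) R₁)))
                  (trans (sym (multiplicity-++ r (replicate (suc k) R₁) Ps)) (part r))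

  data AtomCut : Formula Ω → Sequent Ω → Set₁ where
    atomCut : ∀ {p ts Ξ} → ⊢ (R₂ ⟨ atom p ts ⟩ ∷ Ξ) →
      AtomCut (atom p ts) (T ⟨ atom p ts ⟩ ∷ Ξ)

  atom-cut : Replacement R₁ AtomCut
  atom-cut = record
    { under-shift = λ { (atomCut d) → atomCut (⊢-shift 0 d) }
    ; at-axiom    = λ { {k = k} {Ps} (atomCut {Ξ = Ξ} d) part →
        ⊢-prependCopies k (Exch (prep _ (++-comm (map _ Ps) Ξ))
                                (⊢-split-atom (meet-PartitionOf {k = k} {Ps = Ps} part) d)) }
    ; at-rule     = λ { (atomCut _) () }
    }

  cut-atom : ⊢ (R₁ ⟨ atom p ts ⟩ ∷ Γ₁) → ⊢ (R₂ ⟨ atom p ts ⟩ ∷ Γ₂) →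
    ⊢ (T ⟨ atom p ts ⟩ ∷ Γ₁ ++ Γ₂)
  cut-atom {Γ₁ = Γ₁} {Γ₂ = Γ₂} d₁ d₂ =
    Exch (prep _ (++-comm Γ₂ Γ₁)) (replace₁ atom-cut (atomCut d₂) d₁)

Invertible : RoleSet Ω → Formula Ω → Set
Invertible S (atom _ _)   = ⊥
Invertible S (neg _ _)    = ⊤
Invertible S (conj U _ _) = (U ∈U) S
Invertible S (all U _)    = (U ∈U) S

Invertible-shiftF : ∀ c (A : Formula Ω) → Invertible S A → Invertible S (shiftF c A)
Invertible-shiftF c (neg _ _)    i = i
Invertible-shiftF c (conj _ _ _) i = i
Invertible-shiftF c (all _ _)    i = i

module _ {Rₚ Rₙ T : RoleSet Ω} (meet : Meet T Rₚ Rₙ) (cover : Cover Rₚ Rₙ)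
         (δ : ℕ) (cut< : ∀ {B : Formula Ω} → depth B < δ → Cut B) where
  data PrincipalCut : Formula Ω → Sequent Ω → Set₁ where
    cutWith : ∀ {A Ξ} → Invertible Rₚ A → depth A ≡ δ → ⊢ (Rₚ ⟨ A ⟩ ∷ Ξ) →
      PrincipalCut A (T ⟨ A ⟩ ∷ Ξ)

  principal-cut : Replacement Rₙ PrincipalCut
  principal-cut = record
    { under-shift = λ { (cutWith {A} i eq dₚ) →
        cutWith (Invertible-shiftF 0 A i) (trans (depth-shiftF 0 A) eq) (⊢-shift 0 dₚ) }
    ; at-axiom    = λ { (cutWith () _ _) _ }
    ; at-rule     = at-rule
    }
    where
    cut-below : ∀ A {B} → depth A ≡ δ → depth B < depth A → Cut B
    cut-below _ eq lt = cut< (subst (_ <_) eq lt)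

    at-rule : ∀ {A O Λ} → PrincipalCut A O → Premises Rₙ A Λ → ⊢ (O ++ Λ)
    at-rule (cutWith {A} _ eq dₚ) (byNeg {f} dₙ) =
      Neg (cut-below A eq ≤-refl (meet ∘ f) (cover ∘ f) (Neg-invert dₚ) dₙ)
    at-rule (cutWith {A@(conj U B C)} u eq dₚ) (byAndNegL u∉ dₙ) =
      AndNegL (∉U-meet U meet u∉)
        (cut-below A eq (s≤s (m≤m⊔n _ _)) meet cover (AndPos-invertˡ u dₚ) dₙ)
    at-rule (cutWith {A@(conj U B C)} u eq dₚ) (byAndNegR u∉ dₙ) =
      AndNegR (∉U-meet U meet u∉)
        (cut-below A eq (s≤s (m≤n⊔m _ _)) meet cover (AndPos-invertʳ u dₚ) dₙ)
    at-rule (cutWith {A@(conj U B C)} u eq dₚ) (byAndPos u′ dₙ eₙ) =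
      AndPos (∈U-meet U meet u u′)
        (cut-below A eq (s≤s (m≤m⊔n _ _)) meet cover (AndPos-invertˡ u dₚ) dₙ)
        (cut-below A eq (s≤s (m≤n⊔m _ _)) meet cover (AndPos-invertʳ u dₚ) eₙ)
    at-rule (cutWith {A@(all U B)} u eq dₚ) (byAllNeg t u∉ dₙ) =
      AllNeg t (∉U-meet U meet u∉)
        (cut-below A eq (s≤s (≤-reflexive (depth-[0:=] t B))) meet cover
                   (AllPos-instantiate u t dₚ) dₙ)
    at-rule (cutWith {A@(all U B)} {Ξ} u eq dₚ) (byAllPos {Λ = Λ} u′ dₙ) =
      AllPos (∈U-meet U meet u u′)
        (subst (λ Δ → ⊢ (T ⟨ B ⟩ ∷ Δ)) (sym (map-++ _ Ξ Λ))
          (cut-below A eq ≤-refl meet cover (AllPos-invert u dₚ) dₙ))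

cut-by-inversion : (∀ {B} → depth B < depth A → Cut B) →
  (∀ {R₁ R₂} → Cover R₁ R₂ → Invertible R₁ A ⊎ Invertible R₂ A) → Cut A
cut-by-inversion cut< invertible-side {R₁} {R₂} {Γ₁ = Γ₁} {Γ₂} meet cover d₁ d₂
  with invertible-side cover
... | inj₁ i₁ = replace₁ (principal-cut meet cover _ cut<) (cutWith i₁ refl d₁) d₂
... | inj₂ i₂ =
  Exch (prep _ (++-comm Γ₂ Γ₁))
    (replace₁ (principal-cut (Meet-comm {R₁ = R₁} {R₂} meet) (Cover-comm cover) _ cut<) (cutWith i₂ refl d₂) d₁)

cut : (A : Formula Ω) → Acc _<_ (depth A) → Cut A
cut (atom p ts)  _        meet cover = cut-atom meet cover
cut (neg f B)    (acc rs) = cut-by-inversion (λ lt → cut _ (rs lt)) (λ _ → inj₁ tt)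
cut (conj U B C) (acc rs) = cut-by-inversion (λ lt → cut _ (rs lt)) (∈U-cover U)
cut (all U B)    (acc rs) = cut-by-inversion (λ lt → cut _ (rs lt)) (∈U-cover U)

lemma6 : {Ω : Set} (R₁ R₂ : RoleSet Ω) →
         (∀ r → R₁ r ≡ false → R₂ r ≡ false → ⊥) →
         (Γ₁ Γ₂ : Sequent Ω) (A : Formula Ω) →
         ⊢ (R₁ ⟨ A ⟩ ∷ Γ₁) → ⊢ (R₂ ⟨ A ⟩ ∷ Γ₂) →
         ⊢ ((R₁ ∩ R₂) ⟨ A ⟩ ∷ (Γ₁ ++ Γ₂))
lemma6 R₁ R₂ cover Γ₁ Γ₂ A = cut A (<-wellFounded (depth A)) (λ _ → refl) cover
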